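{- Let $r \geq 4$ and $t \geq r-3$ be integers. Let $H_1, H_2, H_3$ be connected graphs with pairwise disjoint vertex sets, each with $|V(H_i)| \geq t$, and let $u_i \in V(H_i)$ be arbitrary vertices. Let $G_t$ be the graph with vertex set $\{v_1,\dots,v_7\} \cup V(H_1)\cup V(H_2)\cup V(H_3)$ and edge set $E(H_1)\cup E(H_2)\cup E(H_3)\cup\{v_1v_2, v_2v_3, v_1v_4, v_4v_5, v_1v_6, v_6v_7, v_3u_1, v_5u_2, v_7u_3\}$. Then the hypergraph $\mathcal{C}_r(G_t)$ is not $W$-chordal.
   Context: A hypergraph $\mathcal{H}$ consists of a vertex set $V(\mathcal{H})$ and a set $E(\mathcal{H})$ of subsets of it (edges), with no edge contained in another. For a graph $G$ and $r\ge1$, $\mathcal{C}_r(G)$ is the hypergraph on $V(G)$ whose edges are all subsets $S\subseteq V(G)$ with $|S| = r+1$ such that $G[S]$ is connected. For a vertex $v$: the deletion $\mathcal{H}\setminus v$ has vertex set $V(\mathcal{H})\setminus\{v\}$ and edges $\{e\in E(\mathcal{H}) : v\notin e\}$; the contraction $\mathcal{H}/v$ has vertex set $V(\mathcal{H})\setminus\{v\}$ and edges the inclusion-minimal members of $\{e\setminus\{v\} : e\in E(\mathcal{H})\}$. A minor of $\mathcal{H}$ is a hypergraph obtained by deleting a set of vertices and contracting a disjoint set of vertices (the result is independent of order). A vertex $v$ of $\mathcal{H}$ is simplicial if for any two edges $e_1,e_2$ containing $v$ there is an edge $e_3\subseteq (e_1\cup e_2)\setminus\{v\}$. $\mathcal{H}$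 is $W$-chordal if every minor of $\mathcal{H}$ has a simplicial vertex. -}

module Defs where

open import Data.Nat using (ℕ; zero; suc; _+_)
open import Data.Bool using (Bool; true; false; _∧_; _∨_)
open import Data.Fin using (Fin; splitAt; _≟_)
open import Data.Fin.Subset using (Subset; _∈_; _∉_; _⊆_; _∪_; _-_; ∣_∣; ⁅_⁆; ⊤)
open import Data.Sum using (_⊎_; inj₁; inj₂)
open import Data.Product using (Σ; _×_; ∃)
open import Relation.Binary.PropositionalEquality using (_≡_)
open import Relation.Nullary using (¬_)
open import Relation.Nullary.Decidable using (⌊_⌋)

record Graph (n : ℕ) : Set where
  field
    adj    : Fin n → Fin n → Bool
    sym    : ∀ x y → adj x y ≡ adj y x
    irrefl : ∀ x → adj x x ≡ false
open Graph public

data Walk {n : ℕ} (adj : Fin n → Fin n → Bool) (S : Subset n) : Fin n → Fin n → Set where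
  stay : ∀ {x} → x ∈ S → Walk adj S x x
  step : ∀ {x y z} → x ∈ S → adj x y ≡ true → Walk adj S y z → Walk adj S x z

InducedConnected : {n : ℕ} → (Fin n → Fin n → Bool) → Subset n → Set
InducedConnected adj S = ∀ x y → x ∈ S → y ∈ S → Walk adj S x y

Connected : {n : ℕ} → Graph n → Set
Connected G = InducedConnected (adj G) ⊤

record Hypergraph (N : ℕ) : Set₁ where
  field
    verts : Subset N
    Edge  : Subset N → Set
open Hypergraph public

Cr : {N : ℕ} → ℕ → (Fin N → Fin N → Bool) → Hypergraph N
Cr {N} r adj = record
  { verts = ⊤
  ; Edge  = λ S → (∣ S ∣ ≡ suc r) × InducedConnected adj S }

delete : {N : ℕ} → Hypergraph N → Fin N → Hypergraph N
delete H v = record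
  { verts = verts H - v
  ; Edge  = λ e → Edge H e × v ∉ e }

contract : {N : ℕ} → Hypergraph N → Fin N → Hypergraph N
contract H v = record
  { verts = verts H - v
  ; Edge  = λ f → IsC f × (∀ g → IsC g → g ⊆ f → g ≡ f) }
  where
  IsC : Subset _ → Set
  IsC f = ∃ λ e → Edge H e × f ≡ e - v

data Minor {N : ℕ} (H : Hypergraph N) : Hypergraph N → Set₁ where
  here : Minor H H
  del  : ∀ {K} v → Minor H K → v ∈ verts K → Minor H (delete K v)
  con  : ∀ {K} v → Minor H K → v ∈ verts K → Minor H (contract K v)

Simplicial : {N : ℕ} → Hypergraph N → Fin N → Set
Simplicial H v =
  v ∈ verts H ×
  (∀ e₁ e₂ → Edge H e₁ → Edge H e₂ → v ∈ e₁ → v ∈ e₂ → ¬ (e₁ ≡ e₂) →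
     ∃ λ e₃ → Edge H e₃ × e₃ ⊆ ((e₁ ∪ e₂) - v))

WChordal : {N : ℕ} → Hypergraph N → Set₁
WChordal H = ∀ K → Minor H K → (∃ λ w → w ∈ verts K) → ∃ λ v → Simplicial K v

-- The graph G_t.  Vertex set Fin (7 + (n₁ + (n₂ + n₃))):
-- the first 7 vertices are v₁,…,v₇ (indices 0..6), then V(H₁), V(H₂), V(H₃).

Part : ℕ → ℕ → ℕ → Set
Part n₁ n₂ n₃ = Fin 7 ⊎ (Fin n₁ ⊎ (Fin n₂ ⊎ Fin n₃))

classify : {n₁ n₂ n₃ : ℕ} → Fin (7 + (n₁ + (n₂ + n₃))) → Part n₁ n₂ n₃
classify {n₁} {n₂} {n₃} i with splitAt 7 i
... | inj₁ a = inj₁ a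
... | inj₂ j with splitAt n₁ j
...   | inj₁ x = inj₂ (inj₁ x)
...   | inj₂ k with splitAt n₂ k
...     | inj₁ y = inj₂ (inj₂ (inj₁ y))
...     | inj₂ z = inj₂ (inj₂ (inj₂ z))

-- directed version of the path edges among v₁..v₇ (0-indexed):
-- v₁v₂, v₂v₃, v₁v₄, v₄v₅, v₁v₆, v₆v₇
coreDir : Fin 7 → Fin 7 → Bool
coreDir a b =
  (⌊ a ≟ Fin.zero ⌋ ∧ ⌊ b ≟ Fin.suc Fin.zero ⌋) ∨
  (⌊ a ≟ Fin.suc Fin.zero ⌋ ∧ ⌊ b ≟ Fin.suc (Fin.suc Fin.zero) ⌋) ∨
  (⌊ a ≟ Fin.zero ⌋ ∧ ⌊ b ≟ Fin.suc (Fin.suc (Fin.suc Fin.zero)) ⌋) ∨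
  (⌊ a ≟ Fin.suc (Fin.suc (Fin.suc Fin.zero)) ⌋ ∧ ⌊ b ≟ Fin.suc (Fin.suc (Fin.suc (Fin.suc Fin.zero))) ⌋) ∨
  (⌊ a ≟ Fin.zero ⌋ ∧ ⌊ b ≟ Fin.suc (Fin.suc (Fin.suc (Fin.suc (Fin.suc Fin.zero)))) ⌋) ∨
  (⌊ a ≟ Fin.suc (Fin.suc (Fin.suc (Fin.suc (Fin.suc Fin.zero)))) ⌋ ∧ ⌊ b ≟ Fin.suc (Fin.suc (Fin.suc (Fin.suc (Fin.suc (Fin.suc Fin.zero))))) ⌋)
  where import Data.Fin as Fin

core : Fin 7 → Fin 7 → Bool
core a b = coreDir a b ∨ coreDir b a

attach : {m : ℕ} → Fin 7 → Fin 7 → Fin m → Fin m → Bool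
attach idx a u x = ⌊ a ≟ idx ⌋ ∧ ⌊ x ≟ u ⌋

module _ {n₁ n₂ n₃ : ℕ} (H₁ : Graph n₁) (H₂ : Graph n₂) (H₃ : Graph n₃)
         (u₁ : Fin n₁) (u₂ : Fin n₂) (u₃ : Fin n₃) where

  private
    i3 i5 i7 : Fin 7
    i3 = Fin.suc (Fin.suc Fin.zero) where import Data.Fin as Fin
    i5 = Fin.suc (Fin.suc (Fin.suc (Fin.suc Fin.zero))) where import Data.Fin as Fin
    i7 = Fin.suc (Fin.suc (Fin.suc (Fin.suc (Fin.suc (Fin.suc Fin.zero))))) where import Data.Fin as Fin

  adjPart : Part n₁ n₂ n₃ → Part n₁ n₂ n₃ → Bool
  adjPart (inj₁ a) (inj₁ b) = core a b
  adjPart (inj₁ a) (inj₂ (inj₁ x)) = attach i3 a u₁ x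
  adjPart (inj₂ (inj₁ x)) (inj₁ a) = attach i3 a u₁ x
  adjPart (inj₁ a) (inj₂ (inj₂ (inj₁ y))) = attach i5 a u₂ y
  adjPart (inj₂ (inj₂ (inj₁ y))) (inj₁ a) = attach i5 a u₂ y
  adjPart (inj₁ a) (inj₂ (inj₂ (inj₂ z))) = attach i7 a u₃ z
  adjPart (inj₂ (inj₂ (inj₂ z))) (inj₁ a) = attach i7 a u₃ z
  adjPart (inj₂ (inj₁ x)) (inj₂ (inj₁ x')) = adj H₁ x x'
  adjPart (inj₂ (inj₂ (inj₁ y))) (inj₂ (inj₂ (inj₁ y'))) = adj H₂ y y'
  adjPart (inj₂ (inj₂ (inj₂ z))) (inj₂ (inj₂ (inj₂ z'))) = adj H₃ z z'
  adjPart _ _ = false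

  Gt : Fin (7 + (n₁ + (n₂ + n₃))) → Fin (7 + (n₁ + (n₂ + n₃))) → Bool
  Gt i j = adjPart (classify i) (classify j)

module Submission where

-- Write r = 3 + k with k ≥ 1 and choose in each H_i a connected k-set S_i containing u_i.  Deleting
-- the other vertices of the H_i and then contracting the S_i leaves a minor of C_r(G_t) on the
-- spider v₁…v₇: a centre v₁ with three legs of length two, H_i hanging off the end of leg i.
-- An edge of C_r(G_t) avoiding the deleted vertices is a connected (k + 4)-set.  Since only the
-- centre links different legs and H_i is attached to the leg end alone, such a set is too small
-- unless it contains a fork: the centre, all of one leg and the first vertex of another.  Each
-- fork together with its S_i is such an edge, so the edges of the minor are exactly the six
-- forks.  No vertex a is simplicial there: the two forks along the leg of a meet at a, but their
-- union minus a contains no fork.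


open import Defs
open import Data.Nat using (ℕ; _≤_; _∸_; _+_)
open import Data.Fin using (Fin)
open import Relation.Nullary using (¬_)

open import Data.Nat using (zero; suc; s≤s)
open import Data.Nat.Properties
  using (≤-trans; ≤-reflexive; <-irrefl; <⇒≱; n≤1+n; +-identityʳ; m≤m+n)
open import Data.Bool using (Bool; true; false; not; _∧_; if_then_else_)
import Data.Bool as Bool
open import Data.Bool.Properties using (∨-comm; ∧-identityʳ; ∧-conicalˡ; ∧-conicalʳ)
open import Data.Fin using (zero; suc; splitAt; _↑ˡ_; _↑ʳ_; _≟_)
open import Data.Fin.Properties
  using (all?; any?; ¬∀⟶∃¬; splitAt-↑ˡ; splitAt-↑ʳ; splitAt⁻¹-↑ˡ; splitAt⁻¹-↑ʳ)
open import Data.Fin.Subset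
  using (Subset; _∈_; _∉_; _⊆_; _⊂_; _∪_; _─_; _-_; ∣_∣; ⁅_⁆; ⊤; ⊥; inside; outside)
open import Data.Fin.Subset.Properties
  using (_∈?_; _⊆?_; ⊆-refl; ⊆-reflexive; ⊆-trans; ⊆-antisym; p⊆q⇒∣p∣≤∣q∣; ∈⊤; x∈⁅x⁆; x∈⁅y⁆⇒x≡y;
         p⊆p∪q; q⊆p∪q; x∈p∪q⁻; x∈p∪q⁺; ∪-identityʳ; p─q⊆p; x∈p∧x≢y⇒x∈p-y; ∣⁅x⁆∣≡1; ∣⊤∣≡n; ∣⊥∣≡0;
         nonempty?; Empty-unique)
open import Data.Fin.Subset.Induction using (⊂-wellFounded)
open import Data.Vec using ([]; _∷_; _++_; lookup; tabulate; here; there)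
open import Data.Vec.Properties
  using (lookup-++ˡ; lookup-++ʳ; lookup-replicate; lookup∘tabulate; []=⇒lookup; lookup⇒[]=)
open import Data.List using (List; []; _∷_; allFin)
import Data.List.Relation.Unary.Any as Any
open import Data.List.Membership.Propositional using () renaming (_∈_ to _∈ˡ_)
open import Data.List.Membership.Propositional.Properties using (∈-allFin)
open import Data.Product using (∃; ∃₂; _×_; _,_; proj₁; proj₂)
open import Data.Sum using (_⊎_; inj₁; inj₂)
import Data.Sum as Sum
open import Data.Empty as Empty using (⊥-elim)
open import Effect.Monad using (RawMonad)
open import Function using (_∘_)
open import Induction.WellFounded using (Acc; acc)
open import Level using (Level; 0ℓ)
open import Relation.Binary.PropositionalEquality as ≡
  using (_≡_; _≢_; refl; trans; cong; cong₂; subst; subst₂)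
open import Relation.Nullary using (yes; no; ¬?)
open import Relation.Nullary.Decidable
  using (isYes≗does; dec-true; ¬¬-excluded-middle; from-yes; _×-dec_; _⊎-dec_; _→-dec_)
open import Relation.Nullary.Negation using (contradiction; DoubleNegation; ¬¬-Monad)
open import Relation.Unary using (Pred; Decidable)

private
  variable
    ℓ : Level
    n m : ℕ

-- Subsets

∣p∪⁅x⁆∣≡1+∣p∣ : ∀ (p : Subset n) {x} → x ∉ p → ∣ p ∪ ⁅ x ⁆ ∣ ≡ suc ∣ p ∣
∣p∪⁅x⁆∣≡1+∣p∣ (outside ∷ p) {zero}  x∉p = cong suc (cong ∣_∣ (∪-identityʳ p))
∣p∪⁅x⁆∣≡1+∣p∣ (inside  ∷ p) {zero}  x∉p = contradiction here x∉p
∣p∪⁅x⁆∣≡1+∣p∣ (outside ∷ p) {suc x} x∉p = ∣p∪⁅x⁆∣≡1+∣p∣ p (x∉p ∘ there)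
∣p∪⁅x⁆∣≡1+∣p∣ (inside  ∷ p) {suc x} x∉p = cong suc (∣p∪⁅x⁆∣≡1+∣p∣ p (x∉p ∘ there))

x∈p─q⇒x∉q : ∀ (p q : Subset n) {x} → x ∈ p ─ q → x ∉ q
x∈p─q⇒x∉q (_ ∷ p) (inside ∷ q) ()         here
x∈p─q⇒x∉q (_ ∷ p) (_      ∷ q) (there x∈) (there x∈q) = x∈p─q⇒x∉q p q x∈ x∈q

x∈p-y⇒x≢y : ∀ (p : Subset n) {x y} → x ∈ p - y → x ≢ y
x∈p-y⇒x≢y p {y = y} x∈ refl = x∈p─q⇒x∉q p ⁅ y ⁆ x∈ (x∈⁅x⁆ y)

x∈p-y⇒x∈p : ∀ (p : Subset n) {x y} → x ∈ p - y → x ∈ p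
x∈p-y⇒x∈p p {y = y} = p─q⊆p p ⁅ y ⁆

∣p++q∣ : ∀ {m n} (p : Subset m) (q : Subset n) → ∣ p ++ q ∣ ≡ ∣ p ∣ + ∣ q ∣
∣p++q∣ []            q = refl
∣p++q∣ (inside  ∷ p) q = cong suc (∣p++q∣ p q)
∣p++q∣ (outside ∷ p) q = ∣p++q∣ p q

⊆∧¬⊂⇒≡ : ∀ {p q : Subset n} → p ⊆ q → ¬ p ⊂ q → p ≡ q
⊆∧¬⊂⇒≡ {p = p} {q} p⊆q ¬p⊂q = ⊆-antisym p⊆q q⊆p
  where
  q⊆p : q ⊆ p
  q⊆p {x} x∈q with x ∈? p
  ... | yes x∈p = x∈p
  ... | no x∉p  = contradiction ((λ {_} → p⊆q) , x , x∈q , x∉p) ¬p⊂q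

Minimal : Pred (Subset n) ℓ → Pred (Subset n) ℓ
Minimal P y = P y × (∀ z → P z → z ⊆ y → z ≡ y)

module _ {P : Pred (Subset n) 0ℓ} where
  open RawMonad (¬¬-Monad {a = 0ℓ})

  minimal-if-¬smaller : ∀ {x} → P x → ¬ (∃ λ z → z ⊂ x × P z) → Minimal P x
  minimal-if-¬smaller Px ¬smaller = Px , λ z Pz z⊆x → ⊆∧¬⊂⇒≡ z⊆x (λ z⊂x → ¬smaller (z , z⊂x , Pz))

  -- Only double-negated, since P need not be decidable.
  minimal-below : ∀ {x} → P x → DoubleNegation (∃ λ y → y ⊆ x × Minimal P y)
  minimal-below = go (⊂-wellFounded _)
    where
    go : ∀ {x} → Acc _⊂_ x → P x → DoubleNegation (∃ λ y → y ⊆ x × Minimal P y)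
    go {x} (acc below) Px = ¬¬-excluded-middle {A = ∃ λ z → z ⊂ x × P z} >>= λ where
      (yes (z , z⊂x , Pz)) →
        (λ (y , y⊆z , y-min) → y , (λ {_} → ⊆-trans y⊆z (proj₁ z⊂x)) , y-min) <$> go (below z⊂x) Pz
      (no ¬smaller) → pure (x , (λ {_} → ⊆-refl) , minimal-if-¬smaller Px ¬smaller)

-- Walks and connected pieces

module _ {adj : Fin n → Fin n → Bool} where

  walk-source : ∀ {S x y} → Walk adj S x y → x ∈ S
  walk-source (stay x∈S)     = x∈S
  walk-source (step x∈S _ _) = x∈S

  walk-++ : ∀ {S x y z} → Walk adj S x y → Walk adj S y z → Walk adj S x z
  walk-++ (stay _)     w′ = w′
  walk-++ (step p e w) w′ = step p e (walk-++ w w′)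

  walk-mono : ∀ {S T x y} → S ⊆ T → Walk adj S x y → Walk adj T x y
  walk-mono S⊆T (stay p)     = stay (S⊆T p)
  walk-mono S⊆T (step p e w) = step (S⊆T p) e (walk-mono S⊆T w)

  module _ (adj-sym : ∀ x y → adj x y ≡ adj y x) where

    walk-reverse : ∀ {S x y} → Walk adj S x y → Walk adj S y x
    walk-reverse (stay p)                   = stay p
    walk-reverse (step {x} {y} p e w) =
      walk-++ (walk-reverse w) (step (walk-source w) (trans (adj-sym y x) e) (stay p))

    connected-viaRoot : ∀ {S r} → (∀ x → x ∈ S → Walk adj S x r) → InducedConnected adj S
    connected-viaRoot toRoot x y x∈S y∈S = walk-++ (toRoot x x∈S) (walk-reverse (toRoot y y∈S))

  walk-crossing : ∀ {P : Pred (Fin n) ℓ} → Decidable P → ∀ {S x y} → Walk adj S x y → ¬ P x → P y →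
                  ∃₂ λ a b → a ∈ S × b ∈ S × adj a b ≡ true × ¬ P a × P b
  walk-crossing P? (stay _) ¬Px Py = contradiction Py ¬Px
  walk-crossing P? (step {x} {y} p e w) ¬Px Pz with P? y
  ... | yes Py = x , y , p , walk-source w , e , ¬Px , Py
  ... | no ¬Py = walk-crossing P? w ¬Py Pz

walk-map : ∀ {adj : Fin n → Fin n → Bool} {adj′ : Fin m → Fin m → Bool} {S T} (f : Fin n → Fin m) →
           (∀ x y → adj′ (f x) (f y) ≡ adj x y) → (∀ {x} → x ∈ S → f x ∈ T) →
           ∀ {x y} → Walk adj S x y → Walk adj′ T (f x) (f y)
walk-map f f-adj f-mem (stay p)     = stay (f-mem p)
walk-map f f-adj f-mem (step p e w) = step (f-mem p) (trans (f-adj _ _) e) (walk-map f f-adj f-mem w)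

record ConnectedPiece (H : Graph n) (u : Fin n) (k : ℕ) : Set where
  field
    piece     : Subset n
    size      : ∣ piece ∣ ≡ k
    root      : u ∈ piece
    connected : InducedConnected (adj H) piece

connectedPiece : ∀ {H : Graph n} → Connected H → (u : Fin n) → ∀ m → suc m ≤ n →
                 ConnectedPiece H u (suc m)
connectedPiece {H = H} _ u zero _ = record
  { piece = ⁅ u ⁆ ; size = ∣⁅x⁆∣≡1 u ; root = x∈⁅x⁆ u
  ; connected = connected-viaRoot (Graph.sym H) toRoot }
  where
  toRoot : ∀ x → x ∈ ⁅ u ⁆ → Walk (adj H) ⁅ u ⁆ x u
  toRoot x x∈ rewrite x∈⁅y⁆⇒x≡y u x∈ = stay (x∈⁅x⁆ u)
connectedPiece {n} {H} conn u (suc m) 2+m≤n = grown outsider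
  where
  open ConnectedPiece (connectedPiece {H = H} conn u m (≤-trans (n≤1+n _) 2+m≤n))
  outsider : ∃ λ w → w ∉ piece
  outsider with all? (_∈? piece)
  ... | yes all∈ = contradiction n≤1+m (<⇒≱ 2+m≤n)
    where
    n≤1+m : n ≤ suc m
    n≤1+m = subst₂ _≤_ (∣⊤∣≡n n) size (p⊆q⇒∣p∣≤∣q∣ {p = ⊤} (λ {x} _ → all∈ x))
  ... | no ¬all∈ = ¬∀⟶∃¬ n _ (_∈? piece) ¬all∈
  grown : ∃ (λ w → w ∉ piece) → ConnectedPiece H u (suc (suc m))
  grown (w , w∉) with walk-crossing (_∈? piece) (conn w u ∈⊤ ∈⊤) w∉ root
  ... | a , b , _ , _ , ab , a∉ , b∈ = record
    { piece = piece ∪ ⁅ a ⁆ ; size = trans (∣p∪⁅x⁆∣≡1+∣p∣ piece a∉) (cong suc size)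
    ; root = p⊆p∪q ⁅ a ⁆ root ; connected = connected-viaRoot (Graph.sym H) toRoot }
    where
    toRoot : ∀ x → x ∈ piece ∪ ⁅ a ⁆ → Walk (adj H) (piece ∪ ⁅ a ⁆) x u
    toRoot x x∈ with x∈p∪q⁻ piece ⁅ a ⁆ x∈
    ... | inj₁ x∈piece = walk-mono (p⊆p∪q ⁅ a ⁆) (connected x u x∈piece root)
    ... | inj₂ x∈⁅a⁆ rewrite x∈⁅y⁆⇒x≡y a x∈⁅a⁆ =
      step (q⊆p∪q piece ⁅ a ⁆ (x∈⁅x⁆ a)) ab (walk-mono (p⊆p∪q ⁅ a ⁆) (connected b u b∈ root))

-- Sweeping deletions and contractions through a hypergraph

data Reduction : Set where
  deletion contraction : Reduction

module _ {N : ℕ} where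

  reduce : Reduction → Hypergraph N → Fin N → Hypergraph N
  reduce deletion    = delete
  reduce contraction = contract

  verts-reduce : ∀ ρ K v → verts (reduce ρ K v) ≡ verts K - v
  verts-reduce deletion    K v = refl
  verts-reduce contraction K v = refl

  minor-reduce : ∀ ρ {H K v} → Minor H K → v ∈ verts K → Minor H (reduce ρ K v)
  minor-reduce deletion    = del _
  minor-reduce contraction = con _

  EdgesWithinVertices : Hypergraph N → Set
  EdgesWithinVertices K = ∀ e → Edge K e → e ⊆ verts K

  edgesWithinVertices-reduce : ∀ ρ K v → EdgesWithinVertices K → EdgesWithinVertices (reduce ρ K v)
  edgesWithinVertices-reduce deletion K v within e (Ke , v∉e) x∈e =
    x∈p∧x≢y⇒x∈p-y (within e Ke x∈e) λ { refl → v∉e x∈e }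
  edgesWithinVertices-reduce contraction K v within _ ((e , Ke , refl) , _) x∈ =
    x∈p∧x≢y⇒x∈p-y (within e Ke (x∈p-y⇒x∈p e x∈)) (x∈p-y⇒x≢y e x∈)

  module _ (ρ : Reduction) (P : Fin N → Bool) where

    reduceIfMarked : Fin N → Hypergraph N → Hypergraph N
    reduceIfMarked x K with P x | x ∈? verts K
    ... | true | yes _ = reduce ρ K x
    ... | _    | _     = K

    sweep : List (Fin N) → Hypergraph N → Hypergraph N
    sweep []       K = K
    sweep (x ∷ xs) K = sweep xs (reduceIfMarked x K)

    reduceIfMarked-elim : ∀ (Q : Hypergraph N → Set ℓ) x K →
                          (P x ≡ true → x ∈ verts K → Q (reduce ρ K x)) →
                          ((P x ≡ true → x ∉ verts K) → Q K) → Q (reduceIfMarked x K)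
    reduceIfMarked-elim Q x K reduced unchanged with P x | x ∈? verts K
    ... | true  | yes x∈K = reduced refl x∈K
    ... | true  | no  x∉K = unchanged λ _ → x∉K
    ... | false | _       = unchanged λ ()

    sweep-preserves : ∀ (Q : Hypergraph N → Set ℓ) →
                      (∀ {K x} → P x ≡ true → x ∈ verts K → Q K → Q (reduce ρ K x)) →
                      ∀ xs {K} → Q K → Q (sweep xs K)
    sweep-preserves Q preserved []       QK = QK
    sweep-preserves Q preserved (x ∷ xs) {K} QK =
      sweep-preserves Q preserved xs
        (reduceIfMarked-elim Q x K (λ Px x∈K → preserved Px x∈K QK) (λ _ → QK))

    sweep-verts⁻ : ∀ xs {K x} → x ∈ verts (sweep xs K) → x ∈ verts K
    sweep-verts⁻ xs {K} {x} = sweep-preserves (λ K′ → x ∈ verts K′ → x ∈ verts K)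
      (λ {K′} {v} _ _ back x∈ → back (x∈p-y⇒x∈p (verts K′) (subst (x ∈_) (verts-reduce ρ K′ v) x∈)))
      xs (λ x∈ → x∈)

    sweep-verts⁺ : ∀ xs {K x} → x ∈ verts K → P x ≡ false → x ∈ verts (sweep xs K)
    sweep-verts⁺ xs {x = x} x∈K Px≡false = sweep-preserves (λ K′ → x ∈ verts K′)
      (λ {K′} {v} Pv _ x∈ → subst (x ∈_) (≡.sym (verts-reduce ρ K′ v))
        (x∈p∧x≢y⇒x∈p-y x∈ λ { refl → contradiction (trans (≡.sym Px≡false) Pv) λ () }))
      xs x∈K

    sweep-removes : ∀ xs {K x} → x ∈ˡ xs → P x ≡ true → x ∉ verts (sweep xs K)
    sweep-removes (x ∷ xs) {K} (Any.here refl) Px x∈ =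
      reduceIfMarked-elim (λ K′ → x ∉ verts K′) x K
        (λ _ _ x∈′ → x∈p-y⇒x≢y (verts K) (subst (x ∈_) (verts-reduce ρ K x) x∈′) refl)
        (λ absent → absent Px)
        (sweep-verts⁻ xs x∈)
    sweep-removes (_ ∷ xs) (Any.there x∈xs) Px = sweep-removes xs x∈xs Px

    sweep-minor : ∀ xs {H K} → Minor H K → Minor H (sweep xs K)
    sweep-minor xs {H} = sweep-preserves (Minor H) (λ _ v∈K HK → minor-reduce ρ HK v∈K) xs

    sweep-edgesWithinVertices : ∀ xs {K} → EdgesWithinVertices K → EdgesWithinVertices (sweep xs K)
    sweep-edgesWithinVertices =
      sweep-preserves EdgesWithinVertices λ {K} {x} _ _ → edgesWithinVertices-reduce ρ K x

  module _ (P : Fin N → Bool) where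

    sweep-deletion-edge⁻ : ∀ xs {K e} → Edge (sweep deletion P xs K) e → Edge K e
    sweep-deletion-edge⁻ xs {K} {e} =
      sweep-preserves deletion P (λ K′ → Edge K′ e → Edge K e) (λ _ _ back (Ke , _) → back Ke) xs (λ Ke → Ke)

    sweep-deletion-edge⁺ : ∀ xs {K e} → Edge K e → (∀ {x} → P x ≡ true → x ∉ e) →
                           Edge (sweep deletion P xs K) e
    sweep-deletion-edge⁺ xs {e = e} Ke avoids =
      sweep-preserves deletion P (λ K′ → Edge K′ e) (λ Pv _ Ke′ → Ke′ , avoids Pv) xs Ke

    sweep-contraction-edge⁻ : ∀ xs {L f} → Edge (sweep contraction P xs L) f →
                              ∃ λ e → Edge L e × (∀ {x} → P x ≡ false → x ∈ e → x ∈ f)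
    sweep-contraction-edge⁻ xs {L} {f} = sweep-preserves contraction P Remnants contract-remnants xs
      (λ f Lf → f , Lf , λ _ x∈ → x∈) f
      where
      Remnants : Hypergraph N → Set
      Remnants K = ∀ f → Edge K f → ∃ λ e → Edge L e × (∀ {x} → P x ≡ false → x ∈ e → x ∈ f)
      contract-remnants : ∀ {K v} → P v ≡ true → v ∈ verts K → Remnants K → Remnants (contract K v)
      contract-remnants Pv _ remnants _ ((e′ , Ke′ , refl) , _) with remnants e′ Ke′
      ... | e , Le , survives = e , Le ,
        λ Px x∈e → x∈p∧x≢y⇒x∈p-y (survives Px x∈e) λ { refl → contradiction (trans (≡.sym Px) Pv) λ () }

    sweep-contraction-edge⁺ : ∀ xs {L e} → Edge L e →
                              DoubleNegation (∃ λ f → Edge (sweep contraction P xs L) f × f ⊆ e)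
    sweep-contraction-edge⁺ xs {e = e} Le = sweep-preserves contraction P Below contract-below xs
      (pure (e , Le , λ {_} x∈ → x∈))
      where
      open RawMonad (¬¬-Monad {a = 0ℓ})
      Below : Hypergraph N → Set
      Below K = DoubleNegation (∃ λ f → Edge K f × f ⊆ e)
      contract-below : ∀ {K v} → P v ≡ true → v ∈ verts K → Below K → Below (contract K v)
      contract-below {K} {v} _ _ below = do
        f , Kf , f⊆e ← below
        g , g⊆f-v , g-min ← minimal-below {P = λ g → ∃ λ e′ → Edge K e′ × g ≡ e′ - v} (f , Kf , refl)
        pure (g , g-min , λ {_} x∈ → f⊆e (x∈p-y⇒x∈p f (g⊆f-v x∈)))

-- The spider core

-- v₁ is the centre and leg i is near i, far i: (v₂, v₃), (v₄, v₅), (v₆, v₇); H_i hangs off far i.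
centre : Fin 7
centre = zero

near far : Fin 3 → Fin 7
near zero             = suc zero
near (suc zero)       = suc (suc (suc zero))
near (suc (suc zero)) = suc (suc (suc (suc (suc zero))))
far  zero             = suc (suc zero)
far  (suc zero)       = suc (suc (suc (suc zero)))
far  (suc (suc zero)) = suc (suc (suc (suc (suc (suc zero)))))

leg closedLeg : Fin 3 → Subset 7
leg i       = ⁅ near i ⁆ ∪ ⁅ far i ⁆
closedLeg i = ⁅ centre ⁆ ∪ leg i

ball₁ : Subset 7
ball₁ = ⁅ centre ⁆ ∪ ⁅ near zero ⁆ ∪ ⁅ near (suc zero) ⁆ ∪ ⁅ near (suc (suc zero)) ⁆

fork : Fin 3 → Fin 3 → Subset 7
fork i j = closedLeg i ∪ ⁅ near j ⁆

leg-of : Fin 7 → Fin 3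
leg-of zero                                      = zero
leg-of (suc zero)                                = zero
leg-of (suc (suc zero))                          = zero
leg-of (suc (suc (suc zero)))                    = suc zero
leg-of (suc (suc (suc (suc zero))))              = suc zero
leg-of (suc (suc (suc (suc (suc zero)))))        = suc (suc zero)
leg-of (suc (suc (suc (suc (suc (suc zero)))))) = suc (suc zero)

next : Fin 3 → Fin 3
next zero             = suc zero
next (suc zero)       = suc (suc zero)
next (suc (suc zero)) = zero

fork₁ fork₂ : Fin 7 → Subset 7
fork₁ a = fork (leg-of a) (next (leg-of a))
fork₂ a = fork (leg-of a) (next (next (leg-of a)))

-- Facts about the 7-vertex core, checked by evaluating a decision procedure.  They are opaque so
-- that type checking elsewhere never unfolds the (large) evaluated proofs.
opaque

  leg-entry : ∀ i c d → core c d ≡ true → c ∉ leg i → d ∈ leg i → c ≡ centre × d ≡ near i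
  leg-entry = from-yes (all? λ i → all? λ c → all? λ d →
    core c d Bool.≟ true →-dec ¬? (c ∈? leg i) →-dec d ∈? leg i →-dec (c ≟ centre ×-dec d ≟ near i))

  centre∉leg : ∀ i → centre ∉ leg i
  centre∉leg = from-yes (all? λ i → ¬? (centre ∈? leg i))

  off-centre : ∀ a → a ≢ centre → ∃ λ i → a ∈ leg i
  off-centre = from-yes (all? λ a → ¬? (a ≟ centre) →-dec any? λ i → a ∈? leg i)

  off-legs : ∀ a → (∀ i → a ≢ far i) → a ∈ ball₁
  off-legs = from-yes (all? λ a → (all? λ i → ¬? (a ≟ far i)) →-dec a ∈? ball₁)

  near~centre : ∀ i → core (near i) centre ≡ true
  near~centre = from-yes (all? λ i → core (near i) centre Bool.≟ true)

  far~near : ∀ i → core (far i) (near i) ≡ true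
  far~near = from-yes (all? λ i → core (far i) (near i) Bool.≟ true)

  fork⁻ : ∀ i j a → a ∈ fork i j → a ≡ centre ⊎ a ≡ near i ⊎ a ≡ far i ⊎ a ≡ near j
  fork⁻ = from-yes (all? λ i → all? λ j → all? λ a →
    a ∈? fork i j →-dec (a ≟ centre ⊎-dec a ≟ near i ⊎-dec a ≟ far i ⊎-dec a ≟ near j))

  far∈fork⇒≡ : ∀ i j l → far l ∈ fork i j → l ≡ i
  far∈fork⇒≡ = from-yes (all? λ i → all? λ j → all? λ l → far l ∈? fork i j →-dec l ≟ i)

  fork-antichain : ∀ i j i′ j′ → i ≢ j → i′ ≢ j′ → fork i′ j′ ⊆ fork i j → fork i j ⊆ fork i′ j′
  fork-antichain = from-yes (all? λ i → all? λ j → all? λ i′ → all? λ j′ →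
    ¬? (i ≟ j) →-dec ¬? (i′ ≟ j′) →-dec fork i′ j′ ⊆? fork i j →-dec fork i j ⊆? fork i′ j′)

  next-proper : ∀ l → l ≢ next l × l ≢ next (next l)
  next-proper = from-yes (all? λ l → ¬? (l ≟ next l) ×-dec ¬? (l ≟ next (next l)))

  ∈fork₁×fork₂ : ∀ a → a ∈ fork₁ a × a ∈ fork₂ a
  ∈fork₁×fork₂ = from-yes (all? λ a → a ∈? fork₁ a ×-dec a ∈? fork₂ a)

  fork₂⊈fork₁ : ∀ a → ¬ (fork₂ a ⊆ fork₁ a)
  fork₂⊈fork₁ = from-yes (all? λ a → ¬? (fork₂ a ⊆? fork₁ a))

  no-fork-below : ∀ a i j → i ≢ j → ¬ (fork i j ⊆ (fork₁ a ∪ fork₂ a) - a)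
  no-fork-below = from-yes (all? λ a → all? λ i → all? λ j →
    ¬? (i ≟ j) →-dec ¬? (fork i j ⊆? (fork₁ a ∪ fork₂ a) - a))

core-sym : ∀ a b → core a b ≡ core b a
core-sym a b = ∨-comm (coreDir a b) (coreDir b a)

centre∈closedLeg : ∀ i → centre ∈ closedLeg i
centre∈closedLeg i = p⊆p∪q (leg i) (x∈⁅x⁆ centre)

centre∈fork : ∀ i j → centre ∈ fork i j
centre∈fork i j = p⊆p∪q ⁅ near j ⁆ (centre∈closedLeg i)

near∈fork : ∀ i j → near i ∈ fork i j
near∈fork i j = p⊆p∪q ⁅ near j ⁆ (q⊆p∪q ⁅ centre ⁆ (leg i) (p⊆p∪q ⁅ far i ⁆ (x∈⁅x⁆ (near i))))

far∈fork : ∀ i j → far i ∈ fork i j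
far∈fork i j = p⊆p∪q ⁅ near j ⁆ (q⊆p∪q ⁅ centre ⁆ (leg i) (q⊆p∪q ⁅ near i ⁆ ⁅ far i ⁆ (x∈⁅x⁆ (far i))))

fork-toCentre : ∀ i j {a} → a ∈ fork i j → Walk core (fork i j) a centre
fork-toCentre i j {a} a∈ with fork⁻ i j a a∈
... | inj₁ refl               = stay a∈
... | inj₂ (inj₁ refl)        = step a∈ (near~centre i) (stay (centre∈fork i j))
... | inj₂ (inj₂ (inj₁ refl)) =
  step a∈ (far~near i) (step (near∈fork i j) (near~centre i) (stay (centre∈fork i j)))
... | inj₂ (inj₂ (inj₂ refl)) = step a∈ (near~centre j) (stay (centre∈fork i j))

-- The graph G_t

attach-source : ∀ {k} {idx a : Fin 7} {v x : Fin k} → attach idx a v x ≡ true → a ≡ idx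
attach-source {idx = idx} {a} e with a ≟ idx
attach-source e  | yes a≡idx = a≡idx
attach-source () | no _

module Spider {n₁ n₂ n₃ : ℕ} (H₁ : Graph n₁) (H₂ : Graph n₂) (H₃ : Graph n₃)
              (u₁ : Fin n₁) (u₂ : Fin n₂) (u₃ : Fin n₃) where

  N : ℕ
  N = 7 + (n₁ + (n₂ + n₃))

  G : Fin N → Fin N → Bool
  G = Gt H₁ H₂ H₃ u₁ u₂ u₃

  size : Fin 3 → ℕ
  size zero             = n₁
  size (suc zero)       = n₂
  size (suc (suc zero)) = n₃

  H : (i : Fin 3) → Graph (size i)
  H zero             = H₁
  H (suc zero)       = H₂
  H (suc (suc zero)) = H₃

  root : (i : Fin 3) → Fin (size i)
  root zero             = u₁
  root (suc zero)       = u₂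
  root (suc (suc zero)) = u₃

  outer : (i : Fin 3) → Fin (size i) → Part n₁ n₂ n₃
  outer zero             y = inj₂ (inj₁ y)
  outer (suc zero)       y = inj₂ (inj₂ (inj₁ y))
  outer (suc (suc zero)) y = inj₂ (inj₂ (inj₂ y))

  πᵖ : Part n₁ n₂ n₃ → Fin 7
  πᵖ (inj₁ a)                = a
  πᵖ (inj₂ (inj₁ _))         = far zero
  πᵖ (inj₂ (inj₂ (inj₁ _)))  = far (suc zero)
  πᵖ (inj₂ (inj₂ (inj₂ _)))  = far (suc (suc zero))

  adjPart-sym : ∀ p q → adjPart H₁ H₂ H₃ u₁ u₂ u₃ p q ≡ adjPart H₁ H₂ H₃ u₁ u₂ u₃ q p
  adjPart-sym (inj₁ a)               (inj₁ b)               = core-sym a b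
  adjPart-sym (inj₁ a)               (inj₂ (inj₁ y))        = refl
  adjPart-sym (inj₁ a)               (inj₂ (inj₂ (inj₁ y))) = refl
  adjPart-sym (inj₁ a)               (inj₂ (inj₂ (inj₂ y))) = refl
  adjPart-sym (inj₂ (inj₁ x))        (inj₁ b)               = refl
  adjPart-sym (inj₂ (inj₁ x))        (inj₂ (inj₁ y))        = Graph.sym H₁ x y
  adjPart-sym (inj₂ (inj₁ x))        (inj₂ (inj₂ (inj₁ y))) = refl
  adjPart-sym (inj₂ (inj₁ x))        (inj₂ (inj₂ (inj₂ y))) = refl
  adjPart-sym (inj₂ (inj₂ (inj₁ x))) (inj₁ b)               = refl
  adjPart-sym (inj₂ (inj₂ (inj₁ x))) (inj₂ (inj₁ y))        = refl
  adjPart-sym (inj₂ (inj₂ (inj₁ x))) (inj₂ (inj₂ (inj₁ y))) = Graph.sym H₂ x y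
  adjPart-sym (inj₂ (inj₂ (inj₁ x))) (inj₂ (inj₂ (inj₂ y))) = refl
  adjPart-sym (inj₂ (inj₂ (inj₂ x))) (inj₁ b)               = refl
  adjPart-sym (inj₂ (inj₂ (inj₂ x))) (inj₂ (inj₁ y))        = refl
  adjPart-sym (inj₂ (inj₂ (inj₂ x))) (inj₂ (inj₂ (inj₁ y))) = refl
  adjPart-sym (inj₂ (inj₂ (inj₂ x))) (inj₂ (inj₂ (inj₂ y))) = Graph.sym H₃ x y

  -- Only core edges join vertices with different projections: each H_i hangs off far i alone.
  adjPart-fibres : ∀ p q → adjPart H₁ H₂ H₃ u₁ u₂ u₃ p q ≡ true → πᵖ p ≢ πᵖ q →
                   p ≡ inj₁ (πᵖ p) × q ≡ inj₁ (πᵖ q)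
  adjPart-fibres (inj₁ a)               (inj₁ b)               _ _  = refl , refl
  adjPart-fibres (inj₁ a)               (inj₂ (inj₁ y))        e ≢ = contradiction (attach-source e) ≢
  adjPart-fibres (inj₁ a)               (inj₂ (inj₂ (inj₁ y))) e ≢ = contradiction (attach-source e) ≢
  adjPart-fibres (inj₁ a)               (inj₂ (inj₂ (inj₂ y))) e ≢ = contradiction (attach-source e) ≢
  adjPart-fibres (inj₂ (inj₁ x))        (inj₁ b)               e ≢ = contradiction (≡.sym (attach-source e)) ≢
  adjPart-fibres (inj₂ (inj₂ (inj₁ x))) (inj₁ b)               e ≢ = contradiction (≡.sym (attach-source e)) ≢
  adjPart-fibres (inj₂ (inj₂ (inj₂ x))) (inj₁ b)               e ≢ = contradiction (≡.sym (attach-source e)) ≢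
  adjPart-fibres (inj₂ (inj₁ x))        (inj₂ (inj₁ y))        _ ≢ = contradiction refl ≢
  adjPart-fibres (inj₂ (inj₂ (inj₁ x))) (inj₂ (inj₂ (inj₁ y))) _ ≢ = contradiction refl ≢
  adjPart-fibres (inj₂ (inj₂ (inj₂ x))) (inj₂ (inj₂ (inj₂ y))) _ ≢ = contradiction refl ≢
  adjPart-fibres (inj₂ (inj₁ x))        (inj₂ (inj₂ (inj₁ y))) ()
  adjPart-fibres (inj₂ (inj₁ x))        (inj₂ (inj₂ (inj₂ y))) ()
  adjPart-fibres (inj₂ (inj₂ (inj₁ x))) (inj₂ (inj₁ y))        ()
  adjPart-fibres (inj₂ (inj₂ (inj₁ x))) (inj₂ (inj₂ (inj₂ y))) ()
  adjPart-fibres (inj₂ (inj₂ (inj₂ x))) (inj₂ (inj₁ y))        ()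
  adjPart-fibres (inj₂ (inj₂ (inj₂ x))) (inj₂ (inj₂ (inj₁ y))) ()

  embed : Part n₁ n₂ n₃ → Fin N
  embed (inj₁ a)               = a ↑ˡ (n₁ + (n₂ + n₃))
  embed (inj₂ (inj₁ y))        = 7 ↑ʳ (y ↑ˡ (n₂ + n₃))
  embed (inj₂ (inj₂ (inj₁ y))) = 7 ↑ʳ (n₁ ↑ʳ (y ↑ˡ n₃))
  embed (inj₂ (inj₂ (inj₂ y))) = 7 ↑ʳ (n₁ ↑ʳ (n₂ ↑ʳ y))

  classify-embed : ∀ p → classify (embed p) ≡ p
  classify-embed (inj₁ a) rewrite splitAt-↑ˡ 7 a (n₁ + (n₂ + n₃)) = refl
  classify-embed (inj₂ (inj₁ y))
    rewrite splitAt-↑ʳ 7 (n₁ + (n₂ + n₃)) (y ↑ˡ (n₂ + n₃)) | splitAt-↑ˡ n₁ y (n₂ + n₃) = refl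
  classify-embed (inj₂ (inj₂ (inj₁ y)))
    rewrite splitAt-↑ʳ 7 (n₁ + (n₂ + n₃)) (n₁ ↑ʳ (y ↑ˡ n₃)) | splitAt-↑ʳ n₁ (n₂ + n₃) (y ↑ˡ n₃)
          | splitAt-↑ˡ n₂ y n₃ = refl
  classify-embed (inj₂ (inj₂ (inj₂ y)))
    rewrite splitAt-↑ʳ 7 (n₁ + (n₂ + n₃)) (n₁ ↑ʳ (n₂ ↑ʳ y)) | splitAt-↑ʳ n₁ (n₂ + n₃) (n₂ ↑ʳ y)
          | splitAt-↑ʳ n₂ n₃ y = refl

  embed-classify : ∀ x → embed (classify x) ≡ x
  embed-classify x with splitAt 7 x in e₇
  ... | inj₁ a = splitAt⁻¹-↑ˡ e₇
  ... | inj₂ j with splitAt n₁ j in e₁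
  ...   | inj₁ y = trans (cong (7 ↑ʳ_) (splitAt⁻¹-↑ˡ e₁)) (splitAt⁻¹-↑ʳ e₇)
  ...   | inj₂ k with splitAt n₂ k in e₂
  ...     | inj₁ y = trans (cong (λ z → 7 ↑ʳ (n₁ ↑ʳ z)) (splitAt⁻¹-↑ˡ e₂))
                           (trans (cong (7 ↑ʳ_) (splitAt⁻¹-↑ʳ e₁)) (splitAt⁻¹-↑ʳ e₇))
  ...     | inj₂ y = trans (cong (λ z → 7 ↑ʳ (n₁ ↑ʳ z)) (splitAt⁻¹-↑ʳ e₂))
                           (trans (cong (7 ↑ʳ_) (splitAt⁻¹-↑ʳ e₁)) (splitAt⁻¹-↑ʳ e₇))

  body : Fin 7 → Fin N
  body a = embed (inj₁ a)

  out : (i : Fin 3) → Fin (size i) → Fin N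
  out i y = embed (outer i y)

  π : Fin N → Fin 7
  π x = πᵖ (classify x)

  π-embed : ∀ p → π (embed p) ≡ πᵖ p
  π-embed p = cong πᵖ (classify-embed p)

  G-embed : ∀ p q → G (embed p) (embed q) ≡ adjPart H₁ H₂ H₃ u₁ u₂ u₃ p q
  G-embed p q = cong₂ (adjPart H₁ H₂ H₃ u₁ u₂ u₃) (classify-embed p) (classify-embed q)

  G-sym : ∀ x y → G x y ≡ G y x
  G-sym x y = adjPart-sym (classify x) (classify y)

  G-body : ∀ a b → G (body a) (body b) ≡ core a b
  G-body a b = G-embed (inj₁ a) (inj₁ b)

  G-out : ∀ i y y′ → G (out i y) (out i y′) ≡ adj (H i) y y′
  G-out zero             y y′ = G-embed (outer zero y) (outer zero y′)
  G-out (suc zero)       y y′ = G-embed (outer (suc zero) y) (outer (suc zero) y′)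
  G-out (suc (suc zero)) y y′ = G-embed (outer (suc (suc zero)) y) (outer (suc (suc zero)) y′)

  G-attach : ∀ i → G (out i (root i)) (body (far i)) ≡ true
  G-attach i = trans (G-embed (outer i (root i)) (inj₁ (far i))) (attached i)
    where
    attached : ∀ i → adjPart H₁ H₂ H₃ u₁ u₂ u₃ (outer i (root i)) (inj₁ (far i)) ≡ true
    attached zero             = trans (isYes≗does (u₁ ≟ u₁)) (dec-true (u₁ ≟ u₁) refl)
    attached (suc zero)       = trans (isYes≗does (u₂ ≟ u₂)) (dec-true (u₂ ≟ u₂) refl)
    attached (suc (suc zero)) = trans (isYes≗does (u₃ ≟ u₃)) (dec-true (u₃ ≟ u₃) refl)

  G-fibres : ∀ {x y} → G x y ≡ true → π x ≢ π y → x ≡ body (π x) × y ≡ body (π y)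
  G-fibres {x} {y} xy ≢ with adjPart-fibres (classify x) (classify y) xy ≢
  ... | x-core , y-core = trans (≡.sym (embed-classify x)) (cong embed x-core) ,
                          trans (≡.sym (embed-classify y)) (cong embed y-core)

  π-centre : ∀ {x} → π x ≡ centre → x ≡ body centre
  π-centre {x} πx≡centre = trans (≡.sym (embed-classify x)) (cong embed (core-of (classify x) πx≡centre))
    where
    core-of : ∀ p → πᵖ p ≡ centre → p ≡ inj₁ centre
    core-of (inj₁ a)               refl = refl
    core-of (inj₂ (inj₁ _))        ()
    core-of (inj₂ (inj₂ (inj₁ _))) ()
    core-of (inj₂ (inj₂ (inj₂ _))) ()

  π-body : ∀ a → π (body a) ≡ a
  π-body a = π-embed (inj₁ a)

  π-out : ∀ i y → π (out i y) ≡ far i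
  π-out zero             y = π-embed (outer zero y)
  π-out (suc zero)       y = π-embed (outer (suc zero) y)
  π-out (suc (suc zero)) y = π-embed (outer (suc (suc zero)) y)

  data View : Fin N → Set where
    body-view : ∀ a → View (body a)
    out-view  : ∀ i y → View (out i y)

  view : ∀ x → View x
  view x = subst View (embed-classify x) (viewᵖ (classify x))
    where
    viewᵖ : ∀ p → View (embed p)
    viewᵖ (inj₁ a)               = body-view a
    viewᵖ (inj₂ (inj₁ y))        = out-view zero y
    viewᵖ (inj₂ (inj₂ (inj₁ y))) = out-view (suc zero) y
    viewᵖ (inj₂ (inj₂ (inj₂ y))) = out-view (suc (suc zero)) y

-- The non-chordal minor

module NonChordal {n₁ n₂ n₃ : ℕ} (H₁ : Graph n₁) (H₂ : Graph n₂) (H₃ : Graph n₃)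
                  (u₁ : Fin n₁) (u₂ : Fin n₂) (u₃ : Fin n₃) (m : ℕ)
                  (B₁ : ConnectedPiece H₁ u₁ (suc m)) (B₂ : ConnectedPiece H₂ u₂ (suc m))
                  (B₃ : ConnectedPiece H₃ u₃ (suc m)) where

  open Spider H₁ H₂ H₃ u₁ u₂ u₃

  k r : ℕ
  k = suc m
  r = 3 + k

  B : (i : Fin 3) → ConnectedPiece (H i) (root i) k
  B zero             = B₁
  B (suc zero)       = B₂
  B (suc (suc zero)) = B₃

  S : (i : Fin 3) → Subset (size i)
  S i = ConnectedPiece.piece (B i)

  inPieceᵖ keptᵖ : Part n₁ n₂ n₃ → Bool
  inPieceᵖ (inj₁ _)               = false
  inPieceᵖ (inj₂ (inj₁ y))        = lookup (S zero) y
  inPieceᵖ (inj₂ (inj₂ (inj₁ y))) = lookup (S (suc zero)) y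
  inPieceᵖ (inj₂ (inj₂ (inj₂ y))) = lookup (S (suc (suc zero))) y
  keptᵖ (inj₁ _) = true
  keptᵖ (inj₂ y) = inPieceᵖ (inj₂ y)

  inPiece kept deleted : Fin N → Bool
  inPiece x = inPieceᵖ (classify x)
  kept    x = keptᵖ (classify x)
  deleted x = not (kept x)

  block : Subset 7 → (i : Fin 3) → Subset (size i)
  block A i = if lookup A (far i) then S i else ⊥

  -- The kept vertices projecting into A.
  region : Subset 7 → Subset N
  region A = A ++ (block A zero ++ (block A (suc zero) ++ block A (suc (suc zero))))

  lookup-block : ∀ A i y → lookup (block A i) y ≡ lookup A (far i) ∧ lookup (S i) y
  lookup-block A i y with lookup A (far i)
  ... | true  = refl
  ... | false = lookup-replicate y false

  lookup-region : ∀ A p → lookup (region A) (embed p) ≡ lookup A (πᵖ p) ∧ keptᵖ p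
  lookup-region A (inj₁ a) = trans (lookup-++ˡ A _ a) (≡.sym (∧-identityʳ _))
  lookup-region A (inj₂ (inj₁ y)) = begin
    lookup (region A) (7 ↑ʳ (y ↑ˡ _))    ≡⟨ lookup-++ʳ A _ _ ⟩
    lookup (block A zero ++ _) (y ↑ˡ _)  ≡⟨ lookup-++ˡ (block A zero) _ y ⟩
    lookup (block A zero) y              ≡⟨ lookup-block A zero y ⟩
    _                                    ∎
    where open ≡.≡-Reasoning
  lookup-region A (inj₂ (inj₂ (inj₁ y))) = begin
    lookup (region A) (7 ↑ʳ (n₁ ↑ʳ (y ↑ˡ n₃)))              ≡⟨ lookup-++ʳ A _ _ ⟩
    lookup (block A zero ++ _) (n₁ ↑ʳ (y ↑ˡ n₃))            ≡⟨ lookup-++ʳ (block A zero) _ _ ⟩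
    lookup (block A (suc zero) ++ _) (y ↑ˡ n₃)              ≡⟨ lookup-++ˡ (block A (suc zero)) _ y ⟩
    lookup (block A (suc zero)) y                           ≡⟨ lookup-block A (suc zero) y ⟩
    _                                                       ∎
    where open ≡.≡-Reasoning
  lookup-region A (inj₂ (inj₂ (inj₂ y))) = begin
    lookup (region A) (7 ↑ʳ (n₁ ↑ʳ (n₂ ↑ʳ y)))               ≡⟨ lookup-++ʳ A _ _ ⟩
    lookup (block A zero ++ _) (n₁ ↑ʳ (n₂ ↑ʳ y))             ≡⟨ lookup-++ʳ (block A zero) _ _ ⟩
    lookup (block A (suc zero) ++ _) (n₂ ↑ʳ y)               ≡⟨ lookup-++ʳ (block A (suc zero)) _ y ⟩
    lookup (block A (suc (suc zero))) y                      ≡⟨ lookup-block A (suc (suc zero)) y ⟩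
    _                                                        ∎
    where open ≡.≡-Reasoning

  lookup-region′ : ∀ A x → lookup (region A) x ≡ lookup A (π x) ∧ kept x
  lookup-region′ A x = subst (λ z → lookup (region A) z ≡ lookup A (π x) ∧ kept x) (embed-classify x)
                             (lookup-region A (classify x))

  region⁺ : ∀ {A x} → π x ∈ A → kept x ≡ true → x ∈ region A
  region⁺ {A} {x} πx∈A x-kept =
    lookup⇒[]= x (region A) (trans (lookup-region′ A x) (cong₂ _∧_ ([]=⇒lookup πx∈A) x-kept))

  region⁻ : ∀ {A x} → x ∈ region A → π x ∈ A × kept x ≡ true
  region⁻ {A} {x} x∈ = lookup⇒[]= (π x) A (∧-conicalˡ _ _ both) , ∧-conicalʳ _ _ both
    where
    both : lookup A (π x) ∧ kept x ≡ true
    both = trans (≡.sym (lookup-region′ A x)) ([]=⇒lookup x∈)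

  blockSize : Bool → ℕ
  blockSize b = if b then k else 0

  ∣block∣ : ∀ A i → ∣ block A i ∣ ≡ blockSize (lookup A (far i))
  ∣block∣ A i with lookup A (far i)
  ... | true  = ConnectedPiece.size (B i)
  ... | false = ∣⊥∣≡0 (size i)

  ∣region∣ : ∀ A → ∣ region A ∣ ≡ ∣ A ∣ + (blockSize (lookup A (far zero)) +
                   (blockSize (lookup A (far (suc zero))) + blockSize (lookup A (far (suc (suc zero))))))
  ∣region∣ A = begin
    ∣ region A ∣                                              ≡⟨ ∣p++q∣ A _ ⟩
    ∣ A ∣ + ∣ b₀ ++ (b₁ ++ b₂) ∣           ≡⟨ cong (∣ A ∣ +_) (∣p++q∣ b₀ _) ⟩
    ∣ A ∣ + (∣ b₀ ∣ + ∣ b₁ ++ b₂ ∣)         ≡⟨ cong (λ z → ∣ A ∣ + (∣ b₀ ∣ + z)) (∣p++q∣ b₁ b₂) ⟩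
    ∣ A ∣ + (∣ b₀ ∣ + (∣ b₁ ∣ + ∣ b₂ ∣))     ≡⟨ cong (∣ A ∣ +_) (cong₂ _+_ (∣block∣ A zero)
                                               (cong₂ _+_ (∣block∣ A (suc zero)) (∣block∣ A (suc (suc zero))))) ⟩
    _ ∎
    where
    open ≡.≡-Reasoning
    b₀ = block A zero
    b₁ = block A (suc zero)
    b₂ = block A (suc (suc zero))

  ∣region-ball₁∣ : ∣ region ball₁ ∣ ≡ 4
  ∣region-ball₁∣ = ∣region∣ ball₁

  ∣region-closedLeg∣ : ∀ i → ∣ region (closedLeg i) ∣ ≡ 3 + k
  ∣region-closedLeg∣ zero             = trans (∣region∣ (closedLeg zero)) (cong (3 +_) (+-identityʳ k))
  ∣region-closedLeg∣ (suc zero)       = trans (∣region∣ (closedLeg (suc zero))) (cong (3 +_) (+-identityʳ k))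
  ∣region-closedLeg∣ (suc (suc zero)) = ∣region∣ (closedLeg (suc (suc zero)))

  ∣region-fork∣ : ∀ i j → i ≢ j → ∣ region (fork i j) ∣ ≡ 4 + k
  ∣region-fork∣ zero             zero             i≢j = contradiction refl i≢j
  ∣region-fork∣ zero             (suc zero)       _   =
    trans (∣region∣ (fork zero (suc zero))) (cong (4 +_) (+-identityʳ k))
  ∣region-fork∣ zero             (suc (suc zero)) _   =
    trans (∣region∣ (fork zero (suc (suc zero)))) (cong (4 +_) (+-identityʳ k))
  ∣region-fork∣ (suc zero)       zero             _   =
    trans (∣region∣ (fork (suc zero) zero)) (cong (4 +_) (+-identityʳ k))
  ∣region-fork∣ (suc zero)       (suc zero)       i≢j = contradiction refl i≢j
  ∣region-fork∣ (suc zero)       (suc (suc zero)) _   =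
    trans (∣region∣ (fork (suc zero) (suc (suc zero)))) (cong (4 +_) (+-identityʳ k))
  ∣region-fork∣ (suc (suc zero)) zero             _   = ∣region∣ (fork (suc (suc zero)) zero)
  ∣region-fork∣ (suc (suc zero)) (suc zero)       _   = ∣region∣ (fork (suc (suc zero)) (suc zero))
  ∣region-fork∣ (suc (suc zero)) (suc (suc zero)) i≢j = contradiction refl i≢j

  kept-body : ∀ a → kept (body a) ≡ true
  kept-body a = cong keptᵖ (classify-embed (inj₁ a))

  inPiece-body : ∀ a → inPiece (body a) ≡ false
  inPiece-body a = cong inPieceᵖ (classify-embed (inj₁ a))

  kept-out : ∀ i y → kept (out i y) ≡ lookup (S i) y
  kept-out zero             y = cong keptᵖ (classify-embed (outer zero y))
  kept-out (suc zero)       y = cong keptᵖ (classify-embed (outer (suc zero) y))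
  kept-out (suc (suc zero)) y = cong keptᵖ (classify-embed (outer (suc (suc zero)) y))

  trace : Subset N → Subset 7
  trace f = tabulate (λ a → lookup f (body a))

  ∈trace⁺ : ∀ {f a} → body a ∈ f → a ∈ trace f
  ∈trace⁺ {f} {a} a∈ =
    lookup⇒[]= a (trace f) (trans (lookup∘tabulate (λ b → lookup f (body b)) a) ([]=⇒lookup a∈))

  ∈trace⁻ : ∀ {f a} → a ∈ trace f → body a ∈ f
  ∈trace⁻ {f} {a} a∈ =
    lookup⇒[]= (body a) f (trans (≡.sym (lookup∘tabulate (λ b → lookup f (body b)) a)) ([]=⇒lookup a∈))

  module EdgeAnalysis (e : Subset N) (e-size : ∣ e ∣ ≡ suc r) (e-connected : InducedConnected G e)
                      (e-kept : ∀ {x} → x ∈ e → kept x ≡ true) where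

    unconfined : ∀ A → ∣ region A ∣ ≤ 3 + k → ¬ (∀ {y} → y ∈ e → π y ∈ A)
    unconfined A small within =
      <-irrefl refl (subst (_≤ 3 + k) e-size (≤-trans (p⊆q⇒∣p∣≤∣q∣ e⊆region) small))
      where
      e⊆region : e ⊆ region A
      e⊆region y∈ = region⁺ (within y∈) (e-kept y∈)

    core-crossing : ∀ A {x y} → x ∈ e → y ∈ e → π x ∉ A → π y ∈ A →
                    ∃₂ λ c d → core c d ≡ true × c ∉ A × d ∈ A × body c ∈ e × body d ∈ e
    core-crossing A x∈ y∈ πx∉ πy∈ with walk-crossing (λ z → π z ∈? A) (e-connected _ _ x∈ y∈) πx∉ πy∈
    ... | a , b , a∈ , b∈ , ab , πa∉ , πb∈
      with G-fibres ab (λ πa≡πb → πa∉ (subst (_∈ A) (≡.sym πa≡πb) πb∈))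
    ... | a≡ , b≡ =
      π a , π b , trans (≡.sym (G-body (π a) (π b))) (subst₂ (λ x y → G x y ≡ true) a≡ b≡ ab) ,
      πa∉ , πb∈ , subst (_∈ e) a≡ a∈ , subst (_∈ e) b≡ b∈

    e-nonempty : ∃ λ x → x ∈ e
    e-nonempty with nonempty? e
    ... | yes x∈e = x∈e
    ... | no empty =
      contradiction (trans (≡.sym e-size) (trans (cong ∣_∣ (Empty-unique empty)) (∣⊥∣≡0 N))) λ ()

    confined-to-leg : body centre ∉ e → ∀ {x i} → x ∈ e → π x ∈ leg i →
                      ∀ {y} → y ∈ e → π y ∈ closedLeg i
    confined-to-leg centre∉ {x} {i} x∈ πx∈leg {y} y∈ with π y ∈? leg i
    ... | yes πy∈leg = q⊆p∪q ⁅ centre ⁆ (leg i) πy∈leg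
    ... | no πy∉leg with core-crossing (leg i) y∈ x∈ πy∉leg πx∈leg
    ...   | c , d , cd , c∉ , d∈ , c∈ , _ rewrite proj₁ (leg-entry i c d cd c∉ d∈) =
      contradiction c∈ centre∉

    centre∈ : body centre ∈ e
    centre∈ with body centre ∈? e | e-nonempty
    ... | yes c∈ | _ = c∈
    ... | no c∉ | x , x∈ with off-centre (π x) (λ πx≡c → c∉ (subst (_∈ e) (π-centre πx≡c) x∈))
    ...   | i , πx∈leg =
      ⊥-elim (unconfined (closedLeg i) (≤-reflexive (∣region-closedLeg∣ i)) (confined-to-leg c∉ x∈ πx∈leg))

    π-centre∉leg : ∀ i → π (body centre) ∉ leg i
    π-centre∉leg i = subst (_∉ leg i) (≡.sym (π-body centre)) (centre∉leg i)

    leg⇒near∈ : ∀ {i y} → y ∈ e → π y ∈ leg i → body (near i) ∈ e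
    leg⇒near∈ {i} y∈ πy∈ with core-crossing (leg i) centre∈ y∈ (π-centre∉leg i) πy∈
    ... | c , d , cd , c∉ , d∈ , _ , d∈e rewrite proj₂ (leg-entry i c d cd c∉ d∈) = d∈e

    branch⇒far∈ : ∀ {i y} → y ∈ e → π y ≡ far i → body (far i) ∈ e
    branch⇒far∈ {i} y∈ πy≡
      with core-crossing ⁅ far i ⁆ centre∈ y∈ (π-centre∉leg i ∘ q⊆p∪q ⁅ near i ⁆ ⁅ far i ⁆)
                         (subst (_∈ ⁅ far i ⁆) (≡.sym πy≡) (x∈⁅x⁆ (far i)))
    ... | c , d , _ , _ , d∈ , _ , d∈e rewrite x∈⁅y⁆⇒x≡y (far i) d∈ = d∈e

    some-far∈ : ∃ λ i → body (far i) ∈ e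
    some-far∈ with any? (λ i → body (far i) ∈? e)
    ... | yes far∈ = far∈
    ... | no ¬far∈ = ⊥-elim (unconfined ball₁ (subst (_≤ 3 + k) (≡.sym ∣region-ball₁∣) (m≤m+n 4 m))
                                    (λ y∈ → off-legs _ λ i πy≡ → ¬far∈ (i , branch⇒far∈ y∈ πy≡)))

    confined-to-closedLeg : ∀ i → ¬ (∃ λ j → j ≢ i × body (near j) ∈ e) →
                            ∀ {y} → y ∈ e → π y ∈ closedLeg i
    confined-to-closedLeg i ¬near∈ {y} y∈ with π y ∈? closedLeg i
    ... | yes πy∈ = πy∈
    ... | no πy∉
      with off-centre (π y) (λ πy≡c → πy∉ (subst (_∈ closedLeg i) (≡.sym πy≡c) (centre∈closedLeg i)))
    ...   | j , πy∈leg with j ≟ i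
    ...     | yes refl = contradiction (q⊆p∪q ⁅ centre ⁆ (leg i) πy∈leg) πy∉
    ...     | no j≢i   = contradiction (j , j≢i , leg⇒near∈ y∈ πy∈leg) ¬near∈

    other-near∈ : ∀ i → ∃ λ j → j ≢ i × body (near j) ∈ e
    other-near∈ i with any? (λ j → ¬? (j ≟ i) ×-dec body (near j) ∈? e)
    ... | yes near∈ = near∈
    ... | no ¬near∈ =
      ⊥-elim (unconfined (closedLeg i) (≤-reflexive (∣region-closedLeg∣ i)) (confined-to-closedLeg i ¬near∈))

    fork⊆trace : ∃ λ i → ∃ λ j → i ≢ j × fork i j ⊆ trace e
    fork⊆trace with some-far∈
    ... | i , far∈ with other-near∈ i
    ...   | j , j≢i , near-j∈ =
      i , j , (λ i≡j → j≢i (≡.sym i≡j)) , λ a∈ → ∈trace⁺ (members (fork⁻ i j _ a∈))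
      where
      near-i∈ : body (near i) ∈ e
      near-i∈ = leg⇒near∈ far∈ (subst (_∈ leg i) (≡.sym (π-body (far i)))
                                      (q⊆p∪q ⁅ near i ⁆ ⁅ far i ⁆ (x∈⁅x⁆ (far i))))
      members : ∀ {a} → a ≡ centre ⊎ a ≡ near i ⊎ a ≡ far i ⊎ a ≡ near j → body a ∈ e
      members (inj₁ refl)                = centre∈
      members (inj₂ (inj₁ refl))         = near-i∈
      members (inj₂ (inj₂ (inj₁ refl)))  = far∈
      members (inj₂ (inj₂ (inj₂ refl)))  = near-j∈

  -- Every vertex walks to the centre: inside S i to its root, across the attachment, then along the fork.
  region-fork-connected : ∀ i j → InducedConnected G (region (fork i j))
  region-fork-connected i j = connected-viaRoot G-sym toCentre
    where
    body∈ : ∀ {a} → a ∈ fork i j → body a ∈ region (fork i j)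
    body∈ {a} a∈ = region⁺ (subst (_∈ fork i j) (≡.sym (π-body a)) a∈) (kept-body a)
    along-fork : ∀ {a} → a ∈ fork i j → Walk G (region (fork i j)) (body a) (body centre)
    along-fork a∈ = walk-map body G-body body∈ (fork-toCentre i j a∈)
    out∈ : ∀ {y} → y ∈ S i → out i y ∈ region (fork i j)
    out∈ {y} y∈ = region⁺ (subst (_∈ fork i j) (≡.sym (π-out i y)) (far∈fork i j))
                          (trans (kept-out i y) ([]=⇒lookup y∈))
    toCentre : ∀ x → x ∈ region (fork i j) → Walk G (region (fork i j)) x (body centre)
    toCentre x x∈ with view x | region⁻ x∈
    ... | body-view a | πx∈ , _ = along-fork (subst (_∈ fork i j) (π-body a) πx∈)
    ... | out-view l y | πx∈ , y-kept with far∈fork⇒≡ i j l (subst (_∈ fork i j) (π-out l y) πx∈)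
    ...   | refl = walk-++ (walk-map (out i) (G-out i) out∈ (connected y (root i) y∈ root∈))
                           (step (out∈ root∈) (G-attach i) (along-fork (far∈fork i j)))
      where
      open ConnectedPiece (B i) renaming (root to root∈)
      y∈ : y ∈ S i
      y∈ = lookup⇒[]= y (S i) (trans (≡.sym (kept-out i y)) y-kept)

  L K : Hypergraph N
  L = sweep deletion deleted (allFin N) (Cr r G)
  K = sweep contraction inPiece (allFin N) L

  K-minor : Minor (Cr r G) K
  K-minor = sweep-minor contraction inPiece (allFin N) (sweep-minor deletion deleted (allFin N) here)

  L-within : EdgesWithinVertices L
  L-within = sweep-edgesWithinVertices deletion deleted (allFin N) λ _ _ _ → ∈⊤

  L-kept : ∀ {x} → x ∈ verts L → kept x ≡ true
  L-kept {x} x∈ with kept x in kx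
  ... | true  = refl
  ... | false = contradiction x∈ (sweep-removes deletion deleted (allFin N) (∈-allFin x) (cong not kx))

  K-body : ∀ {x} → x ∈ verts K → x ≡ body (π x)
  K-body {x} x∈ with inPiece x in inPiece-x
  ... | true  = contradiction x∈ (sweep-removes contraction inPiece (allFin N) (∈-allFin x) inPiece-x)
  ... | false = trans (≡.sym (embed-classify x)) (cong embed (kept∧¬inPiece⇒core (classify x) x-kept inPiece-x))
    where
    x-kept : kept x ≡ true
    x-kept = L-kept (sweep-verts⁻ contraction inPiece (allFin N) x∈)
    kept∧¬inPiece⇒core : ∀ p → keptᵖ p ≡ true → inPieceᵖ p ≡ false → p ≡ inj₁ (πᵖ p)
    kept∧¬inPiece⇒core (inj₁ _) _    _        = refl
    kept∧¬inPiece⇒core (inj₂ _) kept ¬inPiece = contradiction (trans (≡.sym kept) ¬inPiece) λ ()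

  centre∈K : body centre ∈ verts K
  centre∈K = sweep-verts⁺ contraction inPiece (allFin N)
               (sweep-verts⁺ deletion deleted (allFin N) ∈⊤ (cong not (kept-body centre)))
               (inPiece-body centre)

  K-edge-fork : ∀ {f} → Edge K f → ∃ λ i → ∃ λ j → i ≢ j × fork i j ⊆ trace f
  K-edge-fork Kf with sweep-contraction-edge⁻ inPiece (allFin N) Kf
  ... | e , Le , survives with sweep-deletion-edge⁻ deleted (allFin N) Le
  ...   | e-size , e-connected with EdgeAnalysis.fork⊆trace e e-size e-connected (L-kept ∘ L-within e Le)
  ...     | i , j , i≢j , fork⊆e =
    i , j , i≢j , λ {a} a∈ → ∈trace⁺ (survives (inPiece-body a) (∈trace⁻ (fork⊆e a∈)))

  fork-edge : ∀ i j → i ≢ j → Edge L (region (fork i j))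
  fork-edge i j i≢j = sweep-deletion-edge⁺ deleted (allFin N) (∣region-fork∣ i j i≢j , region-fork-connected i j)
    λ deleted-x x∈ → contradiction (trans (≡.sym (cong not (proj₂ (region⁻ {fork i j} x∈)))) deleted-x) λ ()

  fork-realised : ∀ i j → i ≢ j → DoubleNegation (∃ λ f → Edge K f × trace f ≡ fork i j)
  fork-realised i j i≢j = do
      f , Kf , f⊆region ← sweep-contraction-edge⁺ inPiece (allFin N) (fork-edge i j i≢j)
      let i′ , j′ , i′≢j′ , fork′⊆f = K-edge-fork Kf
          f⊆fork : trace f ⊆ fork i j
          f⊆fork {a} a∈ = subst (_∈ fork i j) (π-body a) (proj₁ (region⁻ (f⊆region (∈trace⁻ a∈))))
          fork⊆f : fork i j ⊆ trace f
          fork⊆f = ⊆-trans (fork-antichain i j i′ j′ i≢j i′≢j′ (⊆-trans fork′⊆f f⊆fork)) fork′⊆f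
      pure (f , Kf , ⊆-antisym f⊆fork fork⊆f)
    where open RawMonad (¬¬-Monad {a = 0ℓ})

  trace-⊆ : ∀ {e f g a} → e ⊆ (f ∪ g) - body a → trace e ⊆ (trace f ∪ trace g) - a
  trace-⊆ {f = f} {g} {a} e⊆ {b} b∈ =
    x∈p∧x≢y⇒x∈p-y (x∈p∪q⁺ (Sum.map ∈trace⁺ ∈trace⁺ (x∈p∪q⁻ f g (x∈p-y⇒x∈p (f ∪ g) b∈′))))
                  λ { refl → x∈p-y⇒x≢y (f ∪ g) b∈′ refl }
    where
    b∈′ : body b ∈ (f ∪ g) - body a
    b∈′ = e⊆ (∈trace⁻ b∈)

  not-simplicial : ∀ v → ¬ Simplicial K v
  not-simplicial v (v∈K , simplicial) =
    fork-realised (leg-of a) _ (proj₁ (next-proper (leg-of a))) λ (f₁ , Kf₁ , trace₁) →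
    fork-realised (leg-of a) _ (proj₂ (next-proper (leg-of a))) λ (f₂ , Kf₂ , trace₂) →
    refute Kf₁ Kf₂ trace₁ trace₂
    where
    a : Fin 7
    a = π v
    v≡body : v ≡ body a
    v≡body = K-body v∈K
    v∈ : ∀ {f A} → trace f ≡ A → a ∈ A → v ∈ f
    v∈ tr a∈ = subst (_∈ _) (≡.sym v≡body) (∈trace⁻ (subst (a ∈_) (≡.sym tr) a∈))
    refute : ∀ {f₁ f₂} → Edge K f₁ → Edge K f₂ → trace f₁ ≡ fork₁ a → trace f₂ ≡ fork₂ a → Empty.⊥
    refute {f₁} {f₂} Kf₁ Kf₂ trace₁ trace₂ =
      let e₃ , Ke₃ , e₃⊆ = simplicial f₁ f₂ Kf₁ Kf₂ (v∈ trace₁ (proj₁ (∈fork₁×fork₂ a)))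
                                                   (v∈ trace₂ (proj₂ (∈fork₁×fork₂ a))) f₁≢f₂
          i , j , i≢j , fork⊆e₃ = K-edge-fork Ke₃
      in no-fork-below a i j i≢j (⊆-trans fork⊆e₃ (below-forks e₃⊆))
      where
      f₁≢f₂ : f₁ ≢ f₂
      f₁≢f₂ refl = fork₂⊈fork₁ a (⊆-reflexive (trans (≡.sym trace₂) trace₁))
      below-forks : ∀ {e₃} → e₃ ⊆ (f₁ ∪ f₂) - v → trace e₃ ⊆ (fork₁ a ∪ fork₂ a) - a
      below-forks {e₃} e₃⊆ = subst₂ (λ A B → trace e₃ ⊆ (A ∪ B) - a) trace₁ trace₂
                                    (trace-⊆ (subst (λ w → e₃ ⊆ (f₁ ∪ f₂) - w) v≡body e₃⊆))

  not-wChordal : ¬ WChordal (Cr r G)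
  not-wChordal wChordal with wChordal K K-minor (body centre , centre∈K)
  ... | v , v-simplicial = not-simplicial v v-simplicial

proposition4p2 : (r t : ℕ) → 4 ≤ r → r ∸ 3 ≤ t →
    {n₁ n₂ n₃ : ℕ} (H₁ : Graph n₁) (H₂ : Graph n₂) (H₃ : Graph n₃) →
    Connected H₁ → Connected H₂ → Connected H₃ →
    t ≤ n₁ → t ≤ n₂ → t ≤ n₃ →
    (u₁ : Fin n₁) (u₂ : Fin n₂) (u₃ : Fin n₃) →
    ¬ WChordal (Cr r (Gt H₁ H₂ H₃ u₁ u₂ u₃))
proposition4p2 (suc (suc (suc (suc m)))) t _ 1+m≤t H₁ H₂ H₃ c₁ c₂ c₃ t≤n₁ t≤n₂ t≤n₃ u₁ u₂ u₃ =
  NonChordal.not-wChordal H₁ H₂ H₃ u₁ u₂ u₃ m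
    (connectedPiece c₁ u₁ m (≤-trans 1+m≤t t≤n₁))
    (connectedPiece c₂ u₂ m (≤-trans 1+m≤t t≤n₂))
    (connectedPiece c₃ u₃ m (≤-trans 1+m≤t t≤n₃))
proposition4p2 zero                  _ ()                   _ _ _ _ _ _ _ _ _ _ _ _ _
proposition4p2 (suc zero)            _ (s≤s ())             _ _ _ _ _ _ _ _ _ _ _ _ _
proposition4p2 (suc (suc zero))      _ (s≤s (s≤s ()))       _ _ _ _ _ _ _ _ _ _ _ _ _
proposition4p2 (suc (suc (suc zero))) _ (s≤s (s≤s (s≤s ()))) _ _ _ _ _ _ _ _ _ _ _ _ _
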